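{- Let $h \in \{0,1,2,3,4,5\}$ and let $\lambda$ be a positive integer such that $\lambda$ is even if $h$ is even. Then there exists a $(3,\lambda)$-GDD $(V,\mathcal{G},\mathcal{B})$ of type $h^1 1^6$ with a $3$-blocking system such that the sets of the system partition the point set of the GDD, each set of the system contains at least two points which are in groups of size $1$, and the sizes of any two sets of the system differ by at most $1$.
   Context: A $(3,\lambda)$-GDD is a triple $(V,\mathcal{G},\mathcal{B})$ where $\mathcal{G}$ is a partition of $V$ into groups and $\mathcal{B}$ a collection of $3$-subsets of $V$ (blocks) such that each pair of points in different groups lies in exactly $\lambda$ blocks and no pair in the same group lies in any block. Type $h^1 1^6$ means one group of size $h$ and six groups of size $1$. A $3$-blocking system is a collection of three pairwise disjoint subsets of $V$ such that every block meets at least two of them. -}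

module Defs where

open import Data.Nat using (ℕ; zero; suc; _≤_)
open import Data.Bool using (Bool; true; false; _∧_)
open import Data.Fin using (Fin)
open import Data.Fin.Subset using (Subset; _∈_; ∣_∣; _∩_; Nonempty)
open import Data.Vec using (lookup)
open import Data.List using (List; []; _∷_; map; replicate)
open import Data.List.Relation.Unary.All using (All)
open import Data.List.Relation.Unary.Any using (Any)
open import Data.List.Relation.Binary.Permutation.Propositional using (_↭_)
open import Data.Product using (Σ; ∃; ∃-syntax; _×_)
open import Relation.Binary.PropositionalEquality using (_≡_; _≢_)
open import Relation.Nullary using (¬_)
open import Data.Empty using (⊥)

count : {A : Set} → (A → Bool) → List A → ℕ
count p [] = 0
count p (a ∷ as) with p a
... | true  = suc (count p as)
... | false = count p as

-- Blocks: a list (multiset; repeated blocks allowed) of 3-subsets of V.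
record GDD3 (lam n : ℕ) : Set where
  field
    groups : List (Subset n)
    blocks : List (Subset n)
    groupsPartition : ∀ (x : Fin n) → count (λ G → lookup G x) groups ≡ 1
    blockSize : All (λ B → ∣ B ∣ ≡ 3) blocks

  SameGroup : Fin n → Fin n → Set
  SameGroup x y = Any (λ G → x ∈ G × y ∈ G) groups

  pairCount : Fin n → Fin n → ℕ
  pairCount x y = count (λ B → lookup B x ∧ lookup B y) blocks

  field
    sameGroupPairs : ∀ (x y : Fin n) → x ≢ y → SameGroup x y → pairCount x y ≡ 0
    crossPairs : ∀ (x y : Fin n) → ¬ SameGroup x y → pairCount x y ≡ lam

  InUnitGroup : Fin n → Set
  InUnitGroup x = Any (λ G → x ∈ G × ∣ G ∣ ≡ 1) groups

open GDD3 public

HasType-h1-16 : ∀ {lam n} → GDD3 lam n → ℕ → Set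
HasType-h1-16 D h = map ∣_∣ (groups D) ↭ (h ∷ replicate 6 1)

IsBlockingSystem3 : ∀ {lam n} → GDD3 lam n → (Fin 3 → Subset n) → Set
IsBlockingSystem3 {n = n} D S =
  (∀ (i j : Fin 3) (x : Fin n) → i ≢ j → x ∈ S i → x ∈ S j → ⊥)
  × All (λ B → ∃[ i ] ∃[ j ] (i ≢ j × Nonempty (B ∩ S i) × Nonempty (B ∩ S j))) (blocks D)

GoodSystem : ∀ {lam n} → GDD3 lam n → (Fin 3 → Subset n) → Set
GoodSystem {n = n} D S =
  -- the sets of the system cover (hence partition) the point set
  (∀ (x : Fin n) → ∃[ i ] (x ∈ S i))
  × (∀ (i : Fin 3) → ∃[ x ] ∃[ y ] (x ≢ y × x ∈ S i × y ∈ S i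
                                     × InUnitGroup D x × InUnitGroup D y))
  × (∀ (i j : Fin 3) → ∣ S i ∣ ≤ suc ∣ S j ∣)

-- For each h ≤ 5 an explicit GDD of type h¹1⁶ with index λ₀ = 1 (h odd) or λ₀ = 2 (h even),
-- together with a blocking system, is checked by evaluating decision procedures for all the
-- axioms. Taking every block λ/λ₀ times yields a GDD of index λ with the same groups; the
-- blocking system and its extra properties carry over, since they constrain only the groups
-- and each block individually.
module Submission where

open import Defs
open import Data.Nat using (ℕ; _≤_)
open import Data.Nat.Divisibility using (_∣_)
open import Data.Fin using (Fin)
open import Data.Fin.Subset using (Subset)
open import Data.Product using (Σ; ∃-syntax; _×_)

open import Data.Nat using (zero; suc; _+_; _*_; _≡ᵇ_; _≤?_; s≤s) renaming (_≟_ to _≟ℕ_)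
open import Data.Nat.Properties using (*-zeroʳ)
open import Data.Nat.Divisibility using (divides; 1∣_)
open import Data.Bool using (Bool; true; false; _∧_)
open import Data.Bool.ListAction using (any)
import Data.Fin as Fin
open import Data.Fin using (toℕ; _≟_)
open import Data.Fin.Properties using (all?; any?)
open import Data.Fin.Subset using (_∈_; ∣_∣; _∩_)
open import Data.Fin.Subset.Properties using (_∈?_; nonempty?)
open import Data.Vec using (tabulate; lookup)
open import Data.List using (List; []; _∷_; _++_; map; concat; replicate; upTo)
import Data.List.Relation.Unary.All as All
open import Data.List.Relation.Unary.All.Properties using (concat⁺; replicate⁺)
open import Data.List.Relation.Unary.Any using (Any)
import Data.List.Relation.Unary.Any as Any
open import Data.List.Relation.Binary.Permutation.Propositional using (↭-refl)
open import Data.Product using (_,_)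
open import Relation.Binary.PropositionalEquality using (_≡_; _≢_; refl; cong; subst; sym; module ≡-Reasoning)
open import Relation.Nullary using (Dec; ¬_; ¬?)
open import Relation.Nullary.Decidable using (True; toWitness; _×-dec_; _→-dec_)

count-++ : ∀ {A : Set} (p : A → Bool) (xs ys : List A) →
           count p (xs ++ ys) ≡ count p xs + count p ys
count-++ p []       ys = refl
count-++ p (x ∷ xs) ys with p x
... | true  = cong suc (count-++ p xs ys)
... | false = count-++ p xs ys

count-concat-replicate : ∀ {A : Set} (p : A → Bool) (k : ℕ) (xs : List A) →
                         count p (concat (replicate k xs)) ≡ k * count p xs
count-concat-replicate p zero    xs = refl
count-concat-replicate p (suc k) xs = begin
  count p (xs ++ concat (replicate k xs))       ≡⟨ count-++ p xs _ ⟩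
  count p xs + count p (concat (replicate k xs)) ≡⟨ cong (count p xs +_) (count-concat-replicate p k xs) ⟩
  count p xs + k * count p xs                    ∎
  where open ≡-Reasoning

repeatBlocks : ∀ {lam n} (k : ℕ) → GDD3 lam n → GDD3 (k * lam) n
repeatBlocks k D = record
  { groups          = groups D
  ; blocks          = concat (replicate k (blocks D))
  ; groupsPartition = groupsPartition D
  ; blockSize       = concat⁺ (replicate⁺ k (blockSize D))
  ; sameGroupPairs  = λ x y x≢y same → begin
      count _ (concat (replicate k (blocks D))) ≡⟨ count-concat-replicate _ k (blocks D) ⟩
      k * pairCount D x y                       ≡⟨ cong (k *_) (sameGroupPairs D x y x≢y same) ⟩
      k * 0                                     ≡⟨ *-zeroʳ k ⟩
      0                                         ∎
  ; crossPairs      = λ x y ¬same → begin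
      count _ (concat (replicate k (blocks D))) ≡⟨ count-concat-replicate _ k (blocks D) ⟩
      k * pairCount D x y                       ≡⟨ cong (k *_) (crossPairs D x y ¬same) ⟩
      k * _                                     ∎
  }
  where open ≡-Reasoning

GoodBlockedGDD : ℕ → ℕ → Set
GoodBlockedGDD h lam = ∃[ n ] Σ (GDD3 lam n) λ D → ∃[ S ]
  (HasType-h1-16 D h × IsBlockingSystem3 D S × GoodSystem D S)

GoodBlockedGDD-* : ∀ {h lam} (k : ℕ) → GoodBlockedGDD h lam → GoodBlockedGDD h (k * lam)
GoodBlockedGDD-* k (n , D , S , type , (disjoint , blocking) , good) =
  n , repeatBlocks k D , S , type , (disjoint , concat⁺ (replicate⁺ k blocking)) , good

GoodBlockedGDD-∣ : ∀ {h d lam} → d ∣ lam → GoodBlockedGDD h d → GoodBlockedGDD h lam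
GoodBlockedGDD-∣ {h} (divides k lam≡k*d) G = subst (GoodBlockedGDD h) (sym lam≡k*d) (GoodBlockedGDD-* k G)

module _ {n : ℕ} (gs : List (Subset n)) where

  sameGroup? : ∀ x y → Dec (Any (λ G → x ∈ G × y ∈ G) gs)
  sameGroup? x y = Any.any? (λ G → (x ∈? G) ×-dec (y ∈? G)) gs

  inUnitGroup? : ∀ x → Dec (Any (λ G → x ∈ G × ∣ G ∣ ≡ 1) gs)
  inUnitGroup? x = Any.any? (λ G → (x ∈? G) ×-dec (∣ G ∣ ≟ℕ 1)) gs

  partitions? : Dec (∀ x → count (λ G → lookup G x) gs ≡ 1)
  partitions? = all? λ x → count (λ G → lookup G x) gs ≟ℕ 1

  module _ (bs : List (Subset n)) where

    pairCountIn : Fin n → Fin n → ℕ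
    pairCountIn x y = count (λ B → lookup B x ∧ lookup B y) bs

    sameGroupPairs? : Dec (∀ x y → x ≢ y → Any (λ G → x ∈ G × y ∈ G) gs → pairCountIn x y ≡ 0)
    sameGroupPairs? = all? λ x → all? λ y →
      ¬? (x ≟ y) →-dec sameGroup? x y →-dec pairCountIn x y ≟ℕ 0

    crossPairs? : ∀ lam → Dec (∀ x y → ¬ Any (λ G → x ∈ G × y ∈ G) gs → pairCountIn x y ≡ lam)
    crossPairs? lam = all? λ x → all? λ y →
      ¬? (sameGroup? x y) →-dec pairCountIn x y ≟ℕ lam

checkedGDD3 : ∀ {n} lam (gs bs : List (Subset n)) →
              {True (partitions? gs)} → {True (All.all? (λ B → ∣ B ∣ ≟ℕ 3) bs)} →
              {True (sameGroupPairs? gs bs)} → {True (crossPairs? gs bs lam)} → GDD3 lam n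
checkedGDD3 lam gs bs {partition} {sizes} {same} {cross} = record
  { groups          = gs
  ; blocks          = bs
  ; groupsPartition = toWitness partition
  ; blockSize       = toWitness sizes
  ; sameGroupPairs  = toWitness same
  ; crossPairs      = toWitness cross
  }

module _ {lam n : ℕ} (D : GDD3 lam n) (S : Fin 3 → Subset n) where

  isBlockingSystem3? : Dec (IsBlockingSystem3 D S)
  isBlockingSystem3? =
    (all? λ i → all? λ j → all? λ x → ¬? (i ≟ j) →-dec x ∈? S i →-dec ¬? (x ∈? S j))
    ×-dec All.all? (λ B → any? λ i → any? λ j →
            ¬? (i ≟ j) ×-dec nonempty? (B ∩ S i) ×-dec nonempty? (B ∩ S j)) (blocks D)

  goodSystem? : Dec (GoodSystem D S)
  goodSystem? =
    (all? λ x → any? λ i → x ∈? S i)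
    ×-dec (all? λ i → any? λ x → any? λ y → ¬? (x ≟ y) ×-dec x ∈? S i ×-dec y ∈? S i
                       ×-dec inUnitGroup? (groups D) x ×-dec inUnitGroup? (groups D) y)
    ×-dec (all? λ i → all? λ j → ∣ S i ∣ ≤? suc ∣ S j ∣)

certify : ∀ {h lam n} (D : GDD3 lam n) (S : Fin 3 → Subset n) → HasType-h1-16 D h →
          {True (isBlockingSystem3? D S ×-dec goodSystem? D S)} → GoodBlockedGDD h lam
certify D S type {checks} = _ , D , S , type , toWitness checks

subset : ∀ {n} → List ℕ → Subset n
subset xs = tabulate λ i → any (toℕ i ≡ᵇ_) xs

typeGroups : ∀ h → List (Subset (h + 6))
typeGroups h = subset (upTo h) ∷ map (λ i → subset (h + i ∷ [])) (upTo 6)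

triples : ∀ {n} → List (ℕ × ℕ × ℕ) → List (Subset n)
triples = map λ (a , b , c) → subset (a ∷ b ∷ c ∷ [])

system : ∀ {n} → List ℕ → List ℕ → List ℕ → Fin 3 → Subset n
system S₀ S₁ S₂ Fin.zero                     = subset S₀
system S₀ S₁ S₂ (Fin.suc Fin.zero)           = subset S₁
system S₀ S₁ S₂ (Fin.suc (Fin.suc Fin.zero)) = subset S₂

goodBlockedGDD₀ : GoodBlockedGDD 0 2
goodBlockedGDD₀ = certify
  (checkedGDD3 2 (typeGroups 0) (triples
    ( (0 , 1 , 5) ∷ (0 , 1 , 2) ∷ (0 , 2 , 4) ∷ (0 , 3 , 4) ∷ (0 , 3 , 5)
    ∷ (1 , 2 , 3) ∷ (1 , 3 , 4) ∷ (1 , 4 , 5) ∷ (2 , 3 , 5) ∷ (2 , 4 , 5) ∷ [])))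
  (system (0 ∷ 1 ∷ []) (2 ∷ 3 ∷ []) (4 ∷ 5 ∷ []))
  ↭-refl

goodBlockedGDD₁ : GoodBlockedGDD 1 1
goodBlockedGDD₁ = certify
  (checkedGDD3 1 (typeGroups 1) (triples
    ( (0 , 1 , 5) ∷ (0 , 2 , 3) ∷ (0 , 4 , 6) ∷ (1 , 2 , 6) ∷ (1 , 3 , 4)
    ∷ (2 , 4 , 5) ∷ (3 , 5 , 6) ∷ [])))
  (system (0 ∷ 1 ∷ 2 ∷ []) (3 ∷ 4 ∷ []) (5 ∷ 6 ∷ []))
  ↭-refl

goodBlockedGDD₂ : GoodBlockedGDD 2 2
goodBlockedGDD₂ = certify
  (checkedGDD3 2 (typeGroups 2) (triples
    ( (0 , 2 , 6) ∷ (0 , 2 , 5) ∷ (0 , 3 , 5) ∷ (0 , 3 , 6) ∷ (0 , 4 , 7) ∷ (0 , 4 , 7)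
    ∷ (1 , 2 , 7) ∷ (1 , 2 , 5) ∷ (1 , 3 , 7) ∷ (1 , 3 , 6) ∷ (1 , 4 , 6) ∷ (1 , 4 , 5)
    ∷ (2 , 3 , 7) ∷ (2 , 3 , 4) ∷ (2 , 4 , 6) ∷ (3 , 4 , 5) ∷ (5 , 6 , 7) ∷ (5 , 6 , 7) ∷ [])))
  (system (0 ∷ 2 ∷ 3 ∷ []) (1 ∷ 4 ∷ 7 ∷ []) (5 ∷ 6 ∷ []))
  ↭-refl

goodBlockedGDD₃ : GoodBlockedGDD 3 1
goodBlockedGDD₃ = certify
  (checkedGDD3 1 (typeGroups 3) (triples
    ( (0 , 3 , 4) ∷ (0 , 5 , 8) ∷ (0 , 6 , 7) ∷ (1 , 3 , 8) ∷ (1 , 4 , 6) ∷ (1 , 5 , 7)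
    ∷ (2 , 3 , 7) ∷ (2 , 4 , 5) ∷ (2 , 6 , 8) ∷ (3 , 5 , 6) ∷ (4 , 7 , 8) ∷ [])))
  (system (0 ∷ 3 ∷ 5 ∷ []) (1 ∷ 4 ∷ 8 ∷ []) (2 ∷ 6 ∷ 7 ∷ []))
  ↭-refl

goodBlockedGDD₄ : GoodBlockedGDD 4 2
goodBlockedGDD₄ = certify
  (checkedGDD3 2 (typeGroups 4) (triples
    ( (0 , 4 , 6) ∷ (0 , 4 , 9) ∷ (0 , 5 , 6) ∷ (0 , 5 , 9) ∷ (0 , 7 , 8) ∷ (0 , 7 , 8)
    ∷ (1 , 4 , 9) ∷ (1 , 4 , 6) ∷ (1 , 5 , 8) ∷ (1 , 5 , 7) ∷ (1 , 6 , 7) ∷ (1 , 8 , 9)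
    ∷ (2 , 4 , 7) ∷ (2 , 4 , 5) ∷ (2 , 5 , 7) ∷ (2 , 6 , 8) ∷ (2 , 6 , 9) ∷ (2 , 8 , 9)
    ∷ (3 , 4 , 7) ∷ (3 , 4 , 8) ∷ (3 , 5 , 9) ∷ (3 , 5 , 6) ∷ (3 , 6 , 8) ∷ (3 , 7 , 9)
    ∷ (4 , 5 , 8) ∷ (6 , 7 , 9) ∷ [])))
  (system (0 ∷ 1 ∷ 4 ∷ 5 ∷ []) (2 ∷ 6 ∷ 7 ∷ []) (3 ∷ 8 ∷ 9 ∷ []))
  ↭-refl

goodBlockedGDD₅ : GoodBlockedGDD 5 1
goodBlockedGDD₅ = certify
  (checkedGDD3 1 (typeGroups 5) (triples
    ( (0 , 5 , 6) ∷ (0 , 7 , 9) ∷ (0 , 8 , 10) ∷ (1 , 5 , 9) ∷ (1 , 6 , 10) ∷ (1 , 7 , 8)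
    ∷ (2 , 5 , 7) ∷ (2 , 6 , 8) ∷ (2 , 9 , 10) ∷ (3 , 5 , 8) ∷ (3 , 6 , 9) ∷ (3 , 7 , 10)
    ∷ (4 , 5 , 10) ∷ (4 , 6 , 7) ∷ (4 , 8 , 9) ∷ [])))
  (system (0 ∷ 1 ∷ 5 ∷ 8 ∷ []) (2 ∷ 3 ∷ 6 ∷ 7 ∷ []) (4 ∷ 9 ∷ 10 ∷ []))
  ↭-refl

lemma6p3 : ∀ (h : ℕ) → h ≤ 5 → ∀ (lam : ℕ) → 1 ≤ lam → (2 ∣ h → 2 ∣ lam) →
    ∃[ n ] Σ (GDD3 lam n) (λ D → ∃[ S ]
      (HasType-h1-16 D h × IsBlockingSystem3 D S × GoodSystem D S))
lemma6p3 0 _ lam _ 2∣lam = GoodBlockedGDD-∣ (2∣lam (divides 0 refl)) goodBlockedGDD₀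
lemma6p3 1 _ lam _ _     = GoodBlockedGDD-∣ (1∣ lam) goodBlockedGDD₁
lemma6p3 2 _ lam _ 2∣lam = GoodBlockedGDD-∣ (2∣lam (divides 1 refl)) goodBlockedGDD₂
lemma6p3 3 _ lam _ _     = GoodBlockedGDD-∣ (1∣ lam) goodBlockedGDD₃
lemma6p3 4 _ lam _ 2∣lam = GoodBlockedGDD-∣ (2∣lam (divides 2 refl)) goodBlockedGDD₄
lemma6p3 5 _ lam _ _     = GoodBlockedGDD-∣ (1∣ lam) goodBlockedGDD₅
lemma6p3 (suc (suc (suc (suc (suc (suc _)))))) (s≤s (s≤s (s≤s (s≤s (s≤s ()))))) _ _ _
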